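{- For all $n\ge2$, \[ \bigcup_{k=1}^{n-1}\ \bigcup_{(a_1,\ldots,a_k)\in A_k^n}\{[a_1,a_2,\ldots,a_k]\}=\mathfrak{T}_{n-1}\setminus\mathfrak{T}_{n-2}=\left\{\frac{s_{n-1,2\ell}}{t_{n-1,2\ell}}:1\le\ell\le 2^{n-2}\right\}. \] Furthermore, if $s_{n,k}/t_{n,k}=[a_1,a_2,\ldots,a_m]\in\mathfrak{T}_n\setminus\mathfrak{T}_{n-1}$, then its two siblings in $\mathfrak{T}_{n+1}\setminus\mathfrak{T}_n$ are, for $\{u,v\}=\{2k,2k-2\}$, \[ \frac{s_{n+1,u}}{t_{n+1,u}}=[a_1,a_2,\ldots,a_{m-1},a_m+1]\quad\text{and}\quad\frac{s_{n+1,v}}{t_{n+1,v}}=[a_1,a_2,\ldots,a_{m-1},a_m-1,2]. \]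
   Context: Stern--Brocot sequence: define integers $s_{n,k},t_{n,k}$ for $n\ge0$, $1\le k\le 2^n+1$ by $s_{0,1}:=0$, $s_{0,2}:=t_{0,1}:=t_{0,2}:=1$; $s_{n+1,2k-1}:=s_{n,k}$ and $t_{n+1,2k-1}:=t_{n,k}$ for $k=1,\ldots,2^n+1$; $s_{n+1,2k}:=s_{n,k}+s_{n,k+1}$ and $t_{n+1,2k}:=t_{n,k}+t_{n,k+1}$ for $k=1,\ldots,2^n$. Let $\mathfrak{T}_n:=\{s_{n,k}/t_{n,k}:k=1,\ldots,2^n+1\}\subset[0,1]$. For $n\ge2$ and $k\ge1$ let $A_k^n:=\{(a_1,\ldots,a_k)\in\mathbb{N}^k:\sum_{i=1}^k a_i=n,\ a_k\neq1\}$, and identify such a tuple with the finite continued fraction $[a_1,\ldots,a_k]=1/(a_1+1/(a_2+\cdots+1/a_k))$. -}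

module Defs where

open import Data.Nat as ℕ using (ℕ; zero; suc; _≤_; _∸_; _^_)
open import Data.Integer using (+_)
open import Data.Rational as ℚ using (ℚ; 0ℚ; _≟_; 1/_; ≢-nonZero)
open import Data.List using (List; []; _∷_; length; last)
open import Data.Nat.ListAction using (sum)
open import Data.List.Relation.Unary.All using (All)
open import Data.Maybe using (just)
open import Data.Product using (Σ; ∃; _×_)
open import Relation.Nullary using (¬_; yes; no)
open import Relation.Binary.PropositionalEquality using (_≡_; _≢_)

-- One refinement step of a Stern–Brocot row, with 1-based positions k:
--   step f (2j-1) = f j          and      step f (2j) = f j + f (j+1).
-- (Realised by shifting: step f (k+2) = step (f ∘ suc) k.  Values at
-- positions outside 1..2^(n+1)+1 are irrelevant junk.)
step : (ℕ → ℕ) → ℕ → ℕ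
step f zero = f 0 ℕ.+ f 1
step f (suc zero) = f 1
step f (suc (suc k)) = step (λ i → f (suc i)) k

-- s n k = s_{n,k},  t n k = t_{n,k}   (meaningful for 1 ≤ k ≤ 2^n + 1)
s : ℕ → ℕ → ℕ
s zero (suc zero) = 0
s zero _ = 1
s (suc n) k = step (s n) k

t : ℕ → ℕ → ℕ
t zero _ = 1
t (suc n) k = step (t n) k

-- the rational p/q (q is always ≥ 1 for the values used; q = 0 gives junk 0)
frac : ℕ → ℕ → ℚ
frac p zero = 0ℚ
frac p (suc q) = (+ p) ℚ./ suc q

st : ℕ → ℕ → ℚ
st n k = frac (s n k) (t n k)

_∈𝔗_ : ℚ → ℕ → Set
x ∈𝔗 n = ∃ λ k → 1 ≤ k × k ≤ 2 ^ n ℕ.+ 1 × st n k ≡ x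

-- total reciprocal (1/0 := 0, never used on 0 for positive partial quotients)
inv : ℚ → ℚ
inv p with p ≟ 0ℚ
... | yes _ = 0ℚ
... | no p≢0 = 1/_ p {{≢-nonZero p≢0}}

cf : List ℕ → ℚ
cf [] = 0ℚ
cf (a ∷ as) = inv ((+ a) ℚ./ 1 ℚ.+ cf as)

InA : ℕ → ℕ → List ℕ → Set
InA k n a = length a ≡ k × All (1 ≤_) a × sum a ≡ n × last a ≢ just 1

{-# OPTIONS --safe #-}
-- Represent [a₁, …, a_k] by the pair (p , q) obtained by folding p/q ↦ q/(a q + p) over the terms,
-- starting from 0/1.  These pairs are coprime, and when all terms are ≥ 1 and the last is ≥ 2 they
-- satisfy 0 < p < q, so the terms can be read off by Euclidean division: such expansions are unique.
-- Row n + 1 of the Stern–Brocot sequence keeps row n at its odd positions and inserts the mediants of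
-- neighbours at its even positions.  By induction on n, the new entry at position 2j + 2 of row n + 1
-- is [as, b] with b ≥ 2 and terms summing to n + 2, and its two neighbours are [as] and [as, b - 1].
-- Its two children, the mediants with these neighbours, are then [as, b + 1] and [as, b - 1, 2], and
-- inverting this step shows that every such expansion of term sum n + 2 occurs.  Entries of row n
-- have term sum at most n + 1, so the new entries of row n + 1 are not old ones.
module Submission where

open import Defs
open import Data.Nat using (ℕ; zero; suc; _≤_; _<_; _∸_; _*_; _+_; _^_; z≤n; s≤s)
open import Data.Nat.Properties
open import Data.Nat.Coprimality using (Coprime; 1-coprimeTo) renaming (sym to coprime-sym)
open import Data.Nat.Divisibility using (∣m+n∣m⇒∣n; ∣-trans; n∣m*n)
open import Data.Nat.ListAction using (sum)
open import Data.Nat.ListAction.Properties using (sum-++)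
open import Data.Nat.Solver using (module +-*-Solver)
open import Data.Integer using (+_)
import Data.Integer as ℤ
import Data.Integer.Properties as ℤ
open import Data.Rational as ℚ using (ℚ; mkℚ)
open import Data.Rational.Properties using (normalize-coprime; mkℚ-injective; /-cong)
open import Data.List using (List; []; _∷_; _++_; length; last; foldr; initLast; _∷ʳ′_)
open import Data.List.Properties using (foldr-++; ++-assoc; length-++)
open import Data.List.Relation.Unary.All as All using (All; []; _∷_)
open import Data.List.Relation.Unary.All.Properties using (++⁺; ++⁻ˡ; ++⁻ʳ)
open import Data.Maybe using (just)
open import Data.Maybe.Properties using (just-injective)
open import Data.Product as × using (∃; ∃₂; _×_; _,_; proj₁; proj₂)
open import Data.Sum as ⊎ using (_⊎_; inj₁; inj₂)
open import Function.Base using (_∘_)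
open import Function.Bundles using (_⇔_; mk⇔)
open import Relation.Nullary using (¬_; contradiction)
open import Relation.Binary.PropositionalEquality

open +-*-Solver using (solve; _:*_; _:+_; _:=_)

-- Continued fractions as pairs of naturals

infixl 6 _⊕_

_⊕_ : ℕ × ℕ → ℕ × ℕ → ℕ × ℕ
(p , q) ⊕ (p′ , q′) = p + p′ , q + q′

⊕-comm : ∀ v w → v ⊕ w ≡ w ⊕ v
⊕-comm (p , q) (p′ , q′) = cong₂ _,_ (+-comm p p′) (+-comm q q′)

-- p / q ↦ 1 / (a + p / q)
cfStep : ℕ → ℕ × ℕ → ℕ × ℕ
cfStep a (p , q) = q , a * q + p

cfPair : List ℕ → ℕ × ℕ
cfPair = foldr cfStep (0 , 1)

fracPair : ℕ × ℕ → ℚ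
fracPair (p , q) = frac p q

cfPair-++ : ∀ as bs → cfPair (as ++ bs) ≡ foldr cfStep (cfPair bs) as
cfPair-++ = foldr-++ cfStep (0 , 1)

cfStep-⊕ : ∀ a v w → cfStep a (v ⊕ w) ≡ cfStep a v ⊕ cfStep a w
cfStep-⊕ a (p , q) (p′ , q′) = cong (q + q′ ,_)
  (solve 5 (λ a p q p′ q′ → a :* (q :+ q′) :+ (p :+ p′) := (a :* q :+ p) :+ (a :* q′ :+ p′))
     refl a p q p′ q′)

foldr-cfStep-⊕ : ∀ as v w → foldr cfStep (v ⊕ w) as ≡ foldr cfStep v as ⊕ foldr cfStep w as
foldr-cfStep-⊕ []       v w = refl
foldr-cfStep-⊕ (a ∷ as) v w = trans (cong (cfStep a) (foldr-cfStep-⊕ as v w)) (cfStep-⊕ a _ _)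

cfPair-mediant : ∀ as c → cfPair (as ++ suc c ∷ []) ≡ cfPair as ⊕ cfPair (as ++ c ∷ [])
cfPair-mediant as c = begin
  cfPair (as ++ suc c ∷ [])                     ≡⟨ cfPair-++ as _ ⟩
  foldr cfStep (cfPair [] ⊕ cfPair (c ∷ [])) as ≡⟨ foldr-cfStep-⊕ as _ _ ⟩
  cfPair as ⊕ foldr cfStep (cfPair (c ∷ [])) as ≡⟨ cong (cfPair as ⊕_) (cfPair-++ as _) ⟨
  cfPair as ⊕ cfPair (as ++ c ∷ [])             ∎
  where open ≡-Reasoning

cfPair-∷ʳ-1 : ∀ as c → cfPair ((as ++ c ∷ []) ++ 1 ∷ []) ≡ cfPair (as ++ suc c ∷ [])
cfPair-∷ʳ-1 as c = begin
  cfPair ((as ++ c ∷ []) ++ 1 ∷ [])     ≡⟨ cong cfPair (++-assoc as (c ∷ []) (1 ∷ [])) ⟩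
  cfPair (as ++ c ∷ 1 ∷ [])             ≡⟨ cfPair-++ as _ ⟩
  foldr cfStep (1 , c * 1 + 1) as       ≡⟨ cong (λ q → foldr cfStep (1 , q) as) (+-suc (c * 1) 0) ⟩
  foldr cfStep (cfPair (suc c ∷ [])) as ≡⟨ cfPair-++ as _ ⟨
  cfPair (as ++ suc c ∷ [])             ∎
  where open ≡-Reasoning

foldr-cfStep-preserves : (P : ℕ × ℕ → Set) → (∀ {a v} → 1 ≤ a → P v → P (cfStep a v)) →
                         ∀ {as v} → All (1 ≤_) as → P v → P (foldr cfStep v as)
foldr-cfStep-preserves P step []           pv = pv
foldr-cfStep-preserves P step (a≥1 ∷ as≥1) pv = step a≥1 (foldr-cfStep-preserves P step as≥1 pv)

Reduced : ℕ × ℕ → Set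
Reduced (p , q) = Coprime p q × 1 ≤ q

cfStep-reduced : ∀ {a v} → 1 ≤ a → Reduced v → Reduced (cfStep a v)
cfStep-reduced {suc a} {p , q} _ (coprime , q≥1) =
  (λ (d∣q , d∣aq+p) → coprime (∣m+n∣m⇒∣n d∣aq+p (∣-trans d∣q (n∣m*n (suc a))) , d∣q)) ,
  ≤-trans q≥1 (≤-trans (m≤m+n q (a * q)) (m≤m+n (suc a * q) p))

cfPair-reduced : ∀ {as} → All (1 ≤_) as → Reduced (cfPair as)
cfPair-reduced as≥1 =
  foldr-cfStep-preserves Reduced cfStep-reduced as≥1 (coprime-sym (1-coprimeTo 0) , ≤-refl)

Proper : ℕ × ℕ → Set
Proper (p , q) = 0 < p × p < q

cfStep-proper : ∀ {a v} → 1 ≤ a → Proper v → Proper (cfStep a v)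
cfStep-proper {suc a} {p , q} _ (p>0 , p<q) =
  <-trans p>0 p<q , <-≤-trans (m<m+n q p>0) (+-monoˡ-≤ p (m≤m+n q (a * q)))

cfPair-∷ʳ-proper : ∀ {as c} → All (1 ≤_) as → 1 ≤ c → Proper (cfPair (as ++ suc c ∷ []))
cfPair-∷ʳ-proper {as} {suc c} as≥1 _ = subst Proper (sym (cfPair-++ as _))
  (foldr-cfStep-preserves Proper cfStep-proper as≥1 (s≤s z≤n , s≤s (s≤s z≤n)))

quotient-unique : ∀ a a′ {q p p′} → p < q → p′ < q →
                  a * q + p ≡ a′ * q + p′ → a ≡ a′ × p ≡ p′
quotient-unique zero    zero         _   _    eq = refl , eq
quotient-unique zero    (suc a′) {q} p<q _    eq =
  contradiction (subst (q ≤_) (sym eq) (≤-trans (m≤m+n q (a′ * q)) (m≤m+n _ _))) (<⇒≱ p<q)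
quotient-unique (suc a) zero     {q} _   p′<q eq =
  contradiction (subst (q ≤_) eq (≤-trans (m≤m+n q (a * q)) (m≤m+n _ _))) (<⇒≱ p′<q)
quotient-unique (suc a) (suc a′) {q} p<q p′<q eq
  with refl , refl ← quotient-unique a a′ p<q p′<q
         (+-cancelˡ-≡ q _ _ (trans (sym (+-assoc q (a * q) _)) (trans eq (+-assoc q (a′ * q) _))))
  = refl , refl

cfStep-injective : ∀ {a a′ p q p′ q′} → p < q → p′ < q′ →
                   cfStep a (p , q) ≡ cfStep a′ (p′ , q′) → a ≡ a′ × (p , q) ≡ (p′ , q′)
cfStep-injective {a} {a′} p<q p′<q′ eq with refl ← cong proj₁ eq
  with refl , refl ← quotient-unique a a′ p<q p′<q′ (cong proj₂ eq) = refl , refl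

cfPair-∷ʳ-injective : ∀ {as c as′ c′} → All (1 ≤_) as → 1 ≤ c → All (1 ≤_) as′ → 1 ≤ c′ →
                      cfPair (as ++ suc c ∷ []) ≡ cfPair (as′ ++ suc c′ ∷ []) →
                      as ≡ as′ × c ≡ c′
cfPair-∷ʳ-injective {[]} {c} {[]} {c′} _ _ _ _ eq =
  refl , *-cancelʳ-≡ c c′ 1 (+-cancelʳ-≡ 0 _ _ (suc-injective (cong proj₂ eq)))
cfPair-∷ʳ-injective {[]} {as′ = _ ∷ _} _ _ (_ ∷ as′≥1) c′≥1 eq
  with p>0 , p<q ← cfPair-∷ʳ-proper as′≥1 c′≥1 =
  contradiction (cong proj₁ eq) (<⇒≢ (≤-<-trans p>0 p<q))
cfPair-∷ʳ-injective {_ ∷ _} {as′ = []} (_ ∷ as≥1) c≥1 _ _ eq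
  with p>0 , p<q ← cfPair-∷ʳ-proper as≥1 c≥1 =
  contradiction (sym (cong proj₁ eq)) (<⇒≢ (≤-<-trans p>0 p<q))
cfPair-∷ʳ-injective {a ∷ _} {as′ = a′ ∷ _} (_ ∷ as≥1) c≥1 (_ ∷ as′≥1) c′≥1 eq
  with refl , eq′ ← cfStep-injective {a} {a′} (proj₂ (cfPair-∷ʳ-proper as≥1 c≥1))
                                               (proj₂ (cfPair-∷ʳ-proper as′≥1 c′≥1)) eq
  with refl , refl ← cfPair-∷ʳ-injective as≥1 c≥1 as′≥1 c′≥1 eq′ = refl , refl

fracPair-injective : ∀ {v w} → Reduced v → Reduced w → fracPair v ≡ fracPair w → v ≡ w
fracPair-injective {p , suc q} {p′ , suc q′} (coprime , _) (coprime′ , _) eq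
  with refl , refl ← mkℚ-injective
         (trans (sym (normalize-coprime coprime)) (trans eq (normalize-coprime coprime′)))
  = refl

-- Once the fractions are in lowest terms, inv merely swaps numerator and denominator.
inv-+-fracPair : ∀ {a v} → 1 ≤ a → Reduced v →
                 inv (+ a ℚ./ 1 ℚ.+ fracPair v) ≡ fracPair (cfStep a v)
inv-+-fracPair {suc a} {p , suc q} a≥1 reduced@(coprime , _) = begin
  inv (+ suc a ℚ./ 1 ℚ.+ + p ℚ./ suc q)
    ≡⟨ cong inv (cong₂ ℚ._+_ (normalize-coprime a-coprime) (normalize-coprime coprime)) ⟩
  inv (mkℚ (+ suc a) 0 a-coprime ℚ.+ mkℚ (+ p) q coprime)
    ≡⟨ cong inv (/-cong (cong₂ ℤ._+_ (sym (ℤ.pos-* (suc a) (suc q))) (ℤ.*-identityʳ (+ p)))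
                        (*-identityˡ (suc q))) ⟩
  inv (+ (suc a * suc q + p) ℚ./ suc q)
    ≡⟨ cong inv (normalize-coprime (coprime-sym coprime′)) ⟩
  mkℚ (+ suc q) (q + a * suc q + p) coprime′
    ≡⟨ normalize-coprime coprime′ ⟨
  fracPair (cfStep (suc a) (p , suc q)) ∎
  where
  open ≡-Reasoning
  a-coprime = coprime-sym (1-coprimeTo (suc a))
  coprime′  = proj₁ (cfStep-reduced a≥1 reduced)

cf-cfPair : ∀ {as} → All (1 ≤_) as → cf as ≡ fracPair (cfPair as)
cf-cfPair                 []           = refl
cf-cfPair {a ∷ _} (a≥1 ∷ as≥1) = trans (cong (λ x → inv (+ a ℚ./ 1 ℚ.+ x)) (cf-cfPair as≥1))
                                       (inv-+-fracPair a≥1 (cfPair-reduced as≥1))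

-- The Stern–Brocot rows

double : ℕ → ℕ
double zero    = zero
double (suc n) = suc (suc (double n))

double≡2* : ∀ n → double n ≡ 2 * n
double≡2* zero    = refl
double≡2* (suc n) = cong suc (trans (cong suc (double≡2* n)) (sym (+-suc n (n + 0))))

double-mono-≤ : ∀ {m n} → m ≤ n → double m ≤ double n
double-mono-≤ z≤n       = z≤n
double-mono-≤ (s≤s m≤n) = s≤s (s≤s (double-mono-≤ m≤n))

double≤1+double⇒≤ : ∀ m n → double m ≤ suc (double n) → m ≤ n
double≤1+double⇒≤ zero    n       _              = z≤n
double≤1+double⇒≤ (suc m) (suc n) (s≤s (s≤s le)) = s≤s (double≤1+double⇒≤ m n le)

data Parity : ℕ → Set where
  even : ∀ j → Parity (double j)
  odd  : ∀ j → Parity (suc (double j))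

parity : ∀ n → Parity n
parity zero = even zero
parity (suc n) with parity n
... | even j = odd j
... | odd j  = even (suc j)

2^suc : ∀ m → 2 ^ suc m ≡ double (2 ^ m)
2^suc m = sym (double≡2* (2 ^ m))

2^suc+1 : ∀ m → 2 ^ suc m + 1 ≡ suc (double (2 ^ m))
2^suc+1 m = trans (+-comm (2 ^ suc m) 1) (cong suc (2^suc m))

child-< : ∀ m {j} → j < 2 ^ m → suc (double j) < 2 ^ suc m
child-< m j< = subst (_ ≤_) (sym (2^suc m)) (double-mono-≤ j<)

parent-< : ∀ m {j} → double j < 2 ^ suc m → j < 2 ^ m
parent-< m {j} lt =
  double≤1+double⇒≤ (suc j) (2 ^ m) (s≤s (subst (suc (double j) ≤_) (2^suc m) lt))

new-position-bound : ∀ m {j} → j < 2 ^ m → double (suc j) ≤ 2 ^ suc m + 1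
new-position-bound m {j} j< =
  subst (double (suc j) ≤_) (sym (2^suc+1 m)) (m≤n⇒m≤1+n (double-mono-≤ j<))

even-position-bound : ∀ m {j} → double (suc j) ≤ 2 ^ suc m + 1 → j < 2 ^ m
even-position-bound m {j} le =
  double≤1+double⇒≤ (suc j) (2 ^ m) (subst (double (suc j) ≤_) (2^suc+1 m) le)

odd-position-bound : ∀ m {j} → suc (double j) ≤ 2 ^ suc m + 1 → suc j ≤ 2 ^ m + 1
odd-position-bound m {j} le = subst (suc j ≤_) (+-comm 1 (2 ^ m))
  (s≤s (double≤1+double⇒≤ j (2 ^ m)
    (m≤n⇒m≤1+n (≤-pred (subst (suc (double j) ≤_) (2^suc+1 m) le)))))

step-odd : ∀ f j → step f (suc (double j)) ≡ f (suc j)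
step-odd f zero    = refl
step-odd f (suc j) = step-odd (f ∘ suc) j

step-even : ∀ f j → step f (double j) ≡ f j + f (suc j)
step-even f zero    = refl
step-even f (suc j) = step-even (f ∘ suc) j

row : ℕ → ℕ → ℕ × ℕ
row n k = s n k , t n k

row-odd : ∀ n j → row (suc n) (suc (double j)) ≡ row n (suc j)
row-odd n j = cong₂ _,_ (step-odd (s n) j) (step-odd (t n) j)

row-even : ∀ n j → row (suc n) (double j) ≡ row n j ⊕ row n (suc j)
row-even n j = cong₂ _,_ (step-even (s n) j) (step-even (t n) j)

record Adjacent (n j : ℕ) (x z : ℕ × ℕ) : Set where
  constructor adjacent
  field
    left  : row n (suc j) ≡ x
    right : row n (suc (suc j)) ≡ z

Flanks : ℕ → ℕ → ℕ × ℕ → ℕ × ℕ → Set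
Flanks n j x z = Adjacent n j x z ⊎ Adjacent n j z x

adjacent-mediant : ∀ {n j x z} → Adjacent n j x z → row (suc n) (double (suc j)) ≡ x ⊕ z
adjacent-mediant {n} {j} (adjacent refl refl) = row-even n (suc j)

flanks-mediant : ∀ {n j x z} → Flanks n j x z → row (suc n) (double (suc j)) ≡ x ⊕ z
flanks-mediant             (inj₁ adj) = adjacent-mediant adj
flanks-mediant {x = x} {z} (inj₂ adj) = trans (adjacent-mediant adj) (⊕-comm z x)

adjacent-children : ∀ {n j x z} → Adjacent n j x z →
  Adjacent (suc n) (double j) x (x ⊕ z) × Adjacent (suc n) (suc (double j)) (x ⊕ z) z
adjacent-children {n} {j} adj@(adjacent left right) =
  adjacent (trans (row-odd n j) left) (adjacent-mediant adj) ,
  adjacent (adjacent-mediant adj) (trans (row-odd n (suc j)) right)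

flanks-children : ∀ {n j x z} → Flanks n j x z →
  (Flanks (suc n) (double j) x (x ⊕ z) × Flanks (suc n) (suc (double j)) (x ⊕ z) z) ⊎
  (Flanks (suc n) (suc (double j)) x (x ⊕ z) × Flanks (suc n) (double j) (x ⊕ z) z)
flanks-children (inj₁ adj) = inj₁ (×.map inj₁ inj₁ (adjacent-children adj))
flanks-children {x = x} {z} (inj₂ adj) rewrite ⊕-comm x z =
  inj₂ (×.map inj₂ inj₂ (×.swap (adjacent-children adj)))

-- Continued fraction expansions of the new entries

sum-∷ʳ : ∀ as c → sum (as ++ c ∷ []) ≡ sum as + c
sum-∷ʳ as c = trans (sum-++ as (c ∷ [])) (cong (_+_ (sum as)) (+-identityʳ c))

-- the continued fraction as ++ [suc c]: terms ≥ 1, last term ≥ 2, terms summing to n + 1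
record Canonical (n : ℕ) (as : List ℕ) (c : ℕ) : Set where
  constructor canonical
  field
    positive : All (1 ≤_) as
    c≥1      : 1 ≤ c
    sum≡     : sum as + c ≡ n

canonical-positive : ∀ {n as c} → Canonical n as c → All (1 ≤_) (as ++ suc c ∷ [])
canonical-positive (canonical as≥1 _ _) = ++⁺ as≥1 (s≤s z≤n ∷ [])

-- The new entry at position 2j + 2 of row m + 1 lies between [as] and [as, c] of row m,
-- so it is their mediant [as, suc c].
record Expansion (m j : ℕ) (as : List ℕ) (c : ℕ) : Set where
  constructor expansion
  field
    isCanonical : Canonical (suc m) as c
    flanks      : Flanks m j (cfPair as) (cfPair (as ++ c ∷ []))

open Expansion

root : Expansion 0 0 [] 1
root = expansion (canonical [] ≤-refl refl) (inj₁ (adjacent refl refl))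

expansion-value : ∀ {m j as c} → Expansion m j as c →
                  row (suc m) (double (suc j)) ≡ cfPair (as ++ suc c ∷ [])
expansion-value {as = as} {c} e = trans (flanks-mediant (flanks e)) (sym (cfPair-mediant as c))

expansion-cf : ∀ {m j as c} → Expansion m j as c →
               st (suc m) (double (suc j)) ≡ cf (as ++ suc c ∷ [])
expansion-cf e =
  trans (cong fracPair (expansion-value e)) (sym (cf-cfPair (canonical-positive (isCanonical e))))

expansion-children : ∀ {m j as c} → Expansion m j as c →
  (Expansion (suc m) (double j) as (suc c) × Expansion (suc m) (suc (double j)) (as ++ c ∷ []) 1) ⊎
  (Expansion (suc m) (suc (double j)) as (suc c) × Expansion (suc m) (double j) (as ++ c ∷ []) 1)
expansion-children {m} {j} {as} {c} (expansion (canonical as≥1 c≥1 sum≡) fl) =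
  ⊎.map (×.map extend append) (×.map extend append) (flanks-children fl)
  where
  extend : ∀ {j′} → Flanks (suc m) j′ (cfPair as) (cfPair as ⊕ cfPair (as ++ c ∷ [])) →
           Expansion (suc m) j′ as (suc c)
  extend fl′ = expansion (canonical as≥1 (s≤s z≤n) (trans (+-suc (sum as) c) (cong suc sum≡)))
                         (subst (Flanks (suc m) _ (cfPair as)) (sym (cfPair-mediant as c)) fl′)
  append : ∀ {j′} → Flanks (suc m) j′ (cfPair as ⊕ cfPair (as ++ c ∷ [])) (cfPair (as ++ c ∷ [])) →
           Expansion (suc m) j′ (as ++ c ∷ []) 1
  append fl′ = expansion
    (canonical (++⁺ as≥1 (c≥1 ∷ [])) ≤-refl
               (trans (+-comm _ 1) (cong suc (trans (sum-∷ʳ as c) sum≡))))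
    (⊎.swap (subst (λ y → Flanks (suc m) _ y (cfPair (as ++ c ∷ [])))
                   (sym (trans (cfPair-∷ʳ-1 as c) (cfPair-mediant as c))) fl′))

children-at : ∀ {m j} → ∃₂ (Expansion m j) →
              ∃₂ (Expansion (suc m) (double j)) × ∃₂ (Expansion (suc m) (suc (double j)))
children-at (_ , _ , e) with expansion-children e
... | inj₁ (e₁ , e₂) = (_ , _ , e₁) , (_ , _ , e₂)
... | inj₂ (e₁ , e₂) = (_ , _ , e₂) , (_ , _ , e₁)

expansion-at : ∀ m j → j < 2 ^ m → ∃₂ (Expansion m j)
expansion-at zero    zero    _        = [] , 1 , root
expansion-at zero    (suc j) (s≤s ())
expansion-at (suc m) j       j< with parity j
... | even j₀ = proj₁ (children-at (expansion-at m j₀ (parent-< m j<)))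
... | odd j₀  = proj₂ (children-at (expansion-at m j₀ (parent-< m (<-trans (n<1+n _) j<))))

position-of : ∀ m {as c} → Canonical (suc m) as c → ∃ λ j → j < 2 ^ m × Expansion m j as c
position-of zero {[]} (canonical [] _ refl) = 0 , s≤s z≤n , root
position-of zero {a ∷ as} (canonical (a≥1 ∷ _) c≥1 sum≡) =
  contradiction (sym sum≡) (<⇒≢ (+-mono-≤ (≤-trans a≥1 (m≤m+n a (sum as))) c≥1))
position-of (suc m) {as} {suc (suc c)} (canonical as≥1 _ sum≡)
  with j , j< , e ← position-of m (canonical as≥1 (s≤s z≤n)
                      (suc-injective (trans (sym (+-suc (sum as) (suc c))) sum≡)))
  with expansion-children e
... | inj₁ (e₁ , _) = double j , <-trans (n<1+n _) (child-< m j<) , e₁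
... | inj₂ (e₁ , _) = suc (double j) , child-< m j< , e₁
position-of (suc m) {as} {suc zero} (canonical as≥1 _ sum≡) with initLast as
... | []         = contradiction sum≡ λ ()
... | as₀ ∷ʳ′ c₀ with c₀≥1 ∷ [] ← ++⁻ʳ as₀ as≥1
  with j , j< , e ← position-of m (canonical (++⁻ˡ as₀ as≥1) c₀≥1
                      (suc-injective (trans (+-comm 1 _)
                                            (trans (cong (_+ 1) (sym (sum-∷ʳ as₀ c₀))) sum≡))))
  with expansion-children e
... | inj₁ (_ , e₂) = suc (double j) , child-< m j< , e₂
... | inj₂ (_ , e₂) = double j , <-trans (n<1+n _) (child-< m j<) , e₂

expansion-unique : ∀ {m j as c as′ c′} → Expansion m j as c → All (1 ≤_) as′ → 1 ≤ c′ →
                   cf (as′ ++ suc c′ ∷ []) ≡ st (suc m) (double (suc j)) →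
                   as′ ≡ as × c′ ≡ c
expansion-unique e@(expansion can@(canonical as≥1 c≥1 _) _) as′≥1 c′≥1 eq =
  cfPair-∷ʳ-injective as′≥1 c′≥1 as≥1 c≥1
    (fracPair-injective (cfPair-reduced positive′) (cfPair-reduced (canonical-positive can))
      (trans (sym (cf-cfPair positive′)) (trans eq (cong fracPair (expansion-value e)))))
  where
  positive′ = ++⁺ as′≥1 (s≤s z≤n ∷ [])

expansion-siblings : ∀ {m j as c} → Expansion m j as c →
  ∃ λ u → ∃ λ v →
    ((u ≡ 2 * double (suc j) × v ≡ 2 * double (suc j) ∸ 2) ⊎
     (u ≡ 2 * double (suc j) ∸ 2 × v ≡ 2 * double (suc j)))
    × st (suc (suc m)) u ≡ cf (as ++ (suc c + 1) ∷ [])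
    × st (suc (suc m)) v ≡ cf (as ++ (suc c ∸ 1) ∷ 2 ∷ [])
expansion-siblings {m} {j} {as} {c} e =
  ⊎.[ (λ (e₁ , e₂) → _ , _ , inj₂ (cong (_∸ 2) 2k , 2k) , extended e₁ , appended e₂)
    , (λ (e₁ , e₂) → _ , _ , inj₁ (2k , cong (_∸ 2) 2k) , extended e₁ , appended e₂)
    ]′ (expansion-children e)
  where
  2k = double≡2* (double (suc j))
  extended : ∀ {j′} → Expansion (suc m) j′ as (suc c) →
             st (suc (suc m)) (double (suc j′)) ≡ cf (as ++ (suc c + 1) ∷ [])
  extended e′ = trans (expansion-cf e′) (cong (λ b → cf (as ++ b ∷ [])) (+-comm 1 (suc c)))
  appended : ∀ {j′} → Expansion (suc m) j′ (as ++ c ∷ []) 1 →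
             st (suc (suc m)) (double (suc j′)) ≡ cf (as ++ c ∷ 2 ∷ [])
  appended e′ = trans (expansion-cf e′) (cong cf (++-assoc as _ _))

-- New entries are not old

-- 0/1, 1/1, or the expansion of a new entry of one of the rows 1, …, m
Shallow : ℕ → ℕ × ℕ → Set
Shallow m v = v ≡ cfPair [] ⊎ v ≡ cfPair (1 ∷ []) ⊎
              ∃₂ λ as c → ∃ λ n → n ≤ m × Canonical n as c × v ≡ cfPair (as ++ suc c ∷ [])

shallow-suc : ∀ {m v} → Shallow m v → Shallow (suc m) v
shallow-suc (inj₁ v≡)                                   = inj₁ v≡
shallow-suc (inj₂ (inj₁ v≡))                            = inj₂ (inj₁ v≡)
shallow-suc (inj₂ (inj₂ (as , c , n , n≤m , can , v≡))) =
  inj₂ (inj₂ (as , c , n , m≤n⇒m≤1+n n≤m , can , v≡))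

shallow-reduced : ∀ {m v} → Shallow m v → Reduced v
shallow-reduced (inj₁ refl)                                = cfPair-reduced []
shallow-reduced (inj₂ (inj₁ refl))                         = cfPair-reduced {1 ∷ []} (s≤s z≤n ∷ [])
shallow-reduced (inj₂ (inj₂ (_ , _ , _ , _ , can , refl))) = cfPair-reduced (canonical-positive can)

shallow-≢-deep : ∀ {m v as c} → Shallow m v → Canonical (suc m) as c →
                 v ≢ cfPair (as ++ suc c ∷ [])
shallow-≢-deep (inj₁ refl) (canonical as≥1 c≥1 _) eq =
  <⇒≢ (proj₁ (cfPair-∷ʳ-proper as≥1 c≥1)) (cong proj₁ eq)
shallow-≢-deep (inj₂ (inj₁ refl)) (canonical as≥1 c≥1 _) eq =
  <-irrefl (trans (sym (cong proj₁ eq)) (cong proj₂ eq)) (proj₂ (cfPair-∷ʳ-proper as≥1 c≥1))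
shallow-≢-deep (inj₂ (inj₂ (_ , _ , n , n≤m , canonical as′≥1 c′≥1 sum≡′ , refl)))
               (canonical as≥1 c≥1 sum≡) eq
  with refl , refl ← cfPair-∷ʳ-injective as′≥1 c′≥1 as≥1 c≥1 eq =
  <-irrefl refl (≤-trans (≤-reflexive (trans (sym sum≡) sum≡′)) n≤m)

row-shallow : ∀ m k → 1 ≤ k → k ≤ 2 ^ m + 1 → Shallow m (row m k)
row-shallow zero    1                   _   _              = inj₁ refl
row-shallow zero    2                   _   _              = inj₂ (inj₁ refl)
row-shallow zero    (suc (suc (suc _))) _   (s≤s (s≤s ()))
row-shallow (suc m) k                   k≥1 k≤ with parity k
... | even zero    = contradiction k≥1 λ ()
... | even (suc j) with as , c , e ← expansion-at m j (even-position-bound m k≤) =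
  inj₂ (inj₂ (as , c , suc m , ≤-refl , isCanonical e , expansion-value e))
... | odd j = subst (Shallow (suc m)) (sym (row-odd m j))
                    (shallow-suc (row-shallow m (suc j) (s≤s z≤n) (odd-position-bound m k≤)))

new-not-old : ∀ m j → j < 2 ^ m → ¬ (st (suc m) (double (suc j)) ∈𝔗 m)
new-not-old m j j< (k , k≥1 , k≤ , eq) with _ , _ , e ← expansion-at m j j< =
  shallow-≢-deep shallow can
    (fracPair-injective (shallow-reduced shallow) (cfPair-reduced (canonical-positive can))
                        (trans eq (cong fracPair (expansion-value e))))
  where
  shallow = row-shallow m k k≥1 k≤
  can     = isCanonical e

new-position : ∀ m k → 1 ≤ k → k ≤ 2 ^ suc m + 1 → ¬ (st (suc m) k ∈𝔗 m) →
               ∃ λ j → j < 2 ^ m × k ≡ double (suc j)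
new-position m k k≥1 k≤ new with parity k
... | even zero    = contradiction k≥1 λ ()
... | even (suc j) = j , even-position-bound m k≤ , refl
... | odd j        =
  contradiction (suc j , s≤s z≤n , odd-position-bound m k≤ , cong fracPair (sym (row-odd m j))) new

positive-≢1⇒suc : ∀ {b} → 1 ≤ b → b ≢ 1 → ∃ λ c → 1 ≤ c × b ≡ suc c
positive-≢1⇒suc {suc zero}    _ b≢1 = contradiction refl b≢1
positive-≢1⇒suc {suc (suc c)} _ _   = suc c , s≤s z≤n , refl

last-∷ʳ : ∀ {A : Set} (xs : List A) x → last (xs ++ x ∷ []) ≡ just x
last-∷ʳ []           x = refl
last-∷ʳ (_ ∷ [])     x = refl
last-∷ʳ (_ ∷ y ∷ ys) x = last-∷ʳ (y ∷ ys) x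

length≤sum : ∀ {as} → All (1 ≤_) as → length as ≤ sum as
length≤sum []           = z≤n
length≤sum (a≥1 ∷ as≥1) = +-mono-≤ a≥1 (length≤sum as≥1)

InA⇒canonical : ∀ {k n L} → 1 ≤ k → InA k (suc n) L →
                ∃₂ λ as c → L ≡ as ++ suc c ∷ [] × Canonical n as c
InA⇒canonical {L = L} k≥1 (len , L≥1 , sum≡ , last≢1) with initLast L
... | []       = contradiction len (<⇒≢ k≥1)
... | as ∷ʳ′ b
  with c , c≥1 , refl ← positive-≢1⇒suc (All.head (++⁻ʳ as L≥1))
                                        (last≢1 ∘ trans (last-∷ʳ as b) ∘ cong just)
  = as , c , refl , canonical (++⁻ˡ as L≥1) c≥1
      (suc-injective (trans (sym (+-suc (sum as) c)) (trans (sym (sum-∷ʳ as _)) sum≡)))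

canonical⇒InA : ∀ {n as c} → Canonical n as c →
                let L = as ++ suc c ∷ [] in 1 ≤ length L × length L ≤ n × InA (length L) (suc n) L
canonical⇒InA {as = as} {c} can@(canonical as≥1 c≥1 sum≡) =
  subst (1 ≤_) (sym len) (m≤n+m 1 (length as)) ,
  subst (_≤ _) (sym len) (subst (_ ≤_) sum≡ (+-mono-≤ (length≤sum as≥1) c≥1)) ,
  refl , canonical-positive can , trans (sum-∷ʳ as _) (trans (+-suc _ _) (cong suc sum≡)) ,
  λ last≡1 → <⇒≢ c≥1 (sym (suc-injective (just-injective (trans (sym (last-∷ʳ as _)) last≡1))))
  where
  len = length-++ as {suc c ∷ []}

-- For n = m + 2, the three sets of the first claim.

CfInA : ℕ → ℚ → Set
CfInA n x = ∃ λ k → 1 ≤ k × k ≤ n ∸ 1 × ∃ λ L → InA k n L × cf L ≡ x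

NewEntry : ℕ → ℚ → Set
NewEntry m x = x ∈𝔗 suc m × ¬ (x ∈𝔗 m)

EvenEntry : ℕ → ℚ → Set
EvenEntry m x = ∃ λ l → 1 ≤ l × l ≤ 2 ^ m × st (suc m) (2 * l) ≡ x

new→even : ∀ m {x} → NewEntry m x → EvenEntry m x
new→even m ((k , k≥1 , k≤ , eq) , new)
  with j , j< , refl ← new-position m k k≥1 k≤ (new ∘ subst (_∈𝔗 m) eq)
  = suc j , s≤s z≤n , j< , trans (cong (st (suc m)) (sym (double≡2* (suc j)))) eq

even→new : ∀ m {x} → EvenEntry m x → NewEntry m x
even→new m (suc j , _ , j< , eq) =
  (double (suc j) , s≤s z≤n , new-position-bound m j< , eq′) ,
  new-not-old m j j< ∘ subst (_∈𝔗 m) (sym eq′)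
  where
  eq′ = trans (cong (st (suc m)) (double≡2* (suc j))) eq

cf→even : ∀ m {x} → CfInA (suc (suc m)) x → EvenEntry m x
cf→even m (k , k≥1 , _ , L , inA , eq)
  with as , c , refl , can ← InA⇒canonical k≥1 inA
  with j , j< , e ← position-of m can
  = suc j , s≤s z≤n , j< ,
    trans (cong (st (suc m)) (sym (double≡2* (suc j)))) (trans (expansion-cf e) eq)

even→cf : ∀ m {x} → EvenEntry m x → CfInA (suc (suc m)) x
even→cf m (suc j , _ , j< , eq)
  with _ , _ , e ← expansion-at m j j<
  with len≥1 , len≤ , inA ← canonical⇒InA (isCanonical e)
  = _ , len≥1 , len≤ , _ , inA ,
    trans (sym (expansion-cf e)) (trans (cong (st (suc m)) (double≡2* (suc j))) eq)

lemma2p2 :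
    ((n : ℕ) → 2 ≤ n → (x : ℚ) →
      ((∃ λ k → 1 ≤ k × k ≤ n ∸ 1 × ∃ λ (a : List ℕ) → InA k n a × cf a ≡ x)
        ⇔ (x ∈𝔗 (n ∸ 1) × ¬ (x ∈𝔗 (n ∸ 2))))
      × ((x ∈𝔗 (n ∸ 1) × ¬ (x ∈𝔗 (n ∸ 2)))
        ⇔ (∃ λ l → 1 ≤ l × l ≤ 2 ^ (n ∸ 2) × st (n ∸ 1) (2 * l) ≡ x)))
    ×
    ((n k : ℕ) (as : List ℕ) (b : ℕ) → 1 ≤ n → 1 ≤ k → k ≤ 2 ^ n + 1 →
      All (1 ≤_) (as ++ b ∷ []) → b ≢ 1 →
      st n k ≡ cf (as ++ b ∷ []) → ¬ (st n k ∈𝔗 (n ∸ 1)) →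
      ∃ λ u → ∃ λ v →
        ((u ≡ 2 * k × v ≡ 2 * k ∸ 2) ⊎ (u ≡ 2 * k ∸ 2 × v ≡ 2 * k))
        × st (suc n) u ≡ cf (as ++ (b + 1) ∷ [])
        × st (suc n) v ≡ cf (as ++ (b ∸ 1) ∷ 2 ∷ []))
lemma2p2 .proj₁ (suc zero)    (s≤s ())
lemma2p2 .proj₁ (suc (suc m)) _ _ =
  mk⇔ (even→new m ∘ cf→even m) (even→cf m ∘ new→even m) , mk⇔ (new→even m) (even→new m)
lemma2p2 .proj₂ (suc m) k as b _ k≥1 k≤ as∷ʳb≥1 b≢1 eq new
  with j , j< , refl ← new-position m k k≥1 k≤ new
  with c , c≥1 , refl ← positive-≢1⇒suc (All.head (++⁻ʳ as as∷ʳb≥1)) b≢1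
  with _ , _ , e ← expansion-at m j j<
  with refl , refl ← expansion-unique e (++⁻ˡ as as∷ʳb≥1) c≥1 (sym eq)
  = expansion-siblings e
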